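{- For positive integers $k$ the following hold: \begin{itemize} \item $\frac{3}{2}k< 2^{o(k+1)}$; \item $k< 2^{2+o(\lceil k/6\rceil+1)}$; \item $k<2^{o(\lceil 2k/3\rceil +1)}$; \item $3k< 2^{o(2k-2)}$ for $k\geq 4$; \item $k\leq 2^{o(k-1)}$ for $k\geq 4$, with strict inequality for $k\geq 5$; \item $k\leq 2^{\lfloor (k+1)/2\rfloor}$, with strict inequality for $k\neq 2,4$; \item $o(\lceil k/2\rceil +1)-\lfloor k/6\rfloor\geq o(\lceil k/8\rceil+1)$; \item $k\leq 2^{o(\lceil k/2\rceil+1)}$, with strict inequality for $k\neq 2,4,8$. \end{itemize}
   Context: For a positive integer $g$, $l(g)=\min\{m : g=\sum_{i=1}^m a_i 2^{n_i},\ a_i\in\{1,3\},\ n_i\geq 0 \text{ integers}\}$ and $o(g)=g-l(g)$. -}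

module Defs where

open import Data.Nat using (ℕ; _+_; _*_; _∸_; _^_; _≤_)
open import Data.List using (List; length; map)
open import Data.Nat.ListAction using (sum)
open import Data.Product using (Σ; _×_; _,_)
open import Relation.Binary.PropositionalEquality using (_≡_)

data Coef : Set where
  one three : Coef

coefVal : Coef → ℕ
coefVal one   = 1
coefVal three = 3

term : Coef × ℕ → ℕ
term (a , n) = coefVal a * 2 ^ n

Rep : ℕ → ℕ → Set
Rep g m = Σ (List (Coef × ℕ)) λ ts → length ts ≡ m × sum (map term ts) ≡ g

IsL : ℕ → ℕ → Set
IsL g m = Rep g m × (∀ m′ → Rep g m′ → m ≤ m′)

IsO : ℕ → ℕ → Set
IsO g x = Σ ℕ λ m → IsL g m × x ≡ g ∸ m

{-# OPTIONS --safe #-}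
module Submission where

open import Defs
open import Data.Nat using (ℕ; zero; suc; _+_; _*_; _∸_; _^_; _/_; _%_; _≤_; _<_; _≤′_; ≤′-refl; ≤′-step; z≤n; s≤s; _≟_; _≤?_; _<?_; allUpTo?)
open import Data.Nat.Properties
open import Data.Nat.DivMod using (m≡m%n+[m/n]*n; m%n<n; m/n<m; m/n*n≤m; m<n*o⇒m/o<n; /-monoˡ-≤)
open import Data.Nat.Induction using (<-rec)
open import Data.Nat.ListAction using (sum)
open import Data.Nat.ListAction.Properties using (sum-++)
open import Data.Nat.Tactic.RingSolver using (solve-∀)
open import Data.List using (List; []; _∷_; length; map; _++_)
open import Data.List.Properties using (length-++; length-map; map-++)
open import Data.Product using (∃-syntax; _×_; _,_; proj₁; proj₂)
open import Data.Sum using (inj₁; inj₂)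
open import Relation.Binary.PropositionalEquality
open import Relation.Nullary using (yes; no; ¬?)
open import Relation.Nullary.Decidable using (True; toWitness; from-yes; _×-dec_; _→-dec_)
open import Relation.Unary using (Decidable)

-- Writing g in base 4, each nonzero digit d ∈ {1,2,3} at place i is a single
-- summand d·4^i ∈ {2^{2i}, 2^{2i+1}, 3·2^{2i}}.  A nonzero digit at place i ≥ 1
-- is worth at least 4, so l(g) ≤ ⌈g/4⌉ and o(g) ≥ ⌊3g/4⌋.  This linear lower
-- bound beats 2^x-type quantities exponentially, which settles every claim for
-- all but finitely many k; the remaining k are decided by computation.

Rep-++ : ∀ {g h m n} → Rep g m → Rep h n → Rep (g + h) (m + n)
Rep-++ (ts , refl , refl) (us , refl , refl) =
  ts ++ us , length-++ ts , trans (cong sum (map-++ term ts us)) (sum-++ (map term ts) (map term us))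

Rep-*4 : ∀ {g m} → Rep g m → Rep (g * 4) m
Rep-*4 (ts , refl , refl) = map times4 ts , length-map times4 ts , sum-times4 ts
  where
  times4 : Coef × ℕ → Coef × ℕ
  times4 (a , n) = a , 2 + n

  term-times4 : ∀ t → term (times4 t) ≡ term t * 4
  term-times4 (a , n) = lemma (coefVal a) (2 ^ n)
    where
    lemma : ∀ c p → c * (2 * (2 * p)) ≡ c * p * 4
    lemma = solve-∀

  sum-times4 : ∀ ts → sum (map term (map times4 ts)) ≡ sum (map term ts) * 4
  sum-times4 []       = refl
  sum-times4 (t ∷ ts) = trans (cong₂ _+_ (term-times4 t) (sum-times4 ts))
                              (sym (*-distribʳ-+ 4 (term t) (sum (map term ts))))

Rep-digit : ∀ r → 0 < r → r < 4 → Rep r 1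
Rep-digit 1 _ _ = (one   , 0) ∷ [] , refl , refl
Rep-digit 2 _ _ = (one   , 1) ∷ [] , refl , refl
Rep-digit 3 _ _ = (three , 0) ∷ [] , refl , refl
Rep-digit (suc (suc (suc (suc _)))) _ (s≤s (s≤s (s≤s (s≤s ()))))

term-positive : ∀ t → 0 < term t
term-positive (a , n) = *-mono-≤ (coefVal-positive a) (m^n>0 2 n)
  where
  coefVal-positive : ∀ a → 0 < coefVal a
  coefVal-positive one   = s≤s z≤n
  coefVal-positive three = s≤s z≤n

Rep⇒length≤ : ∀ {g m} → Rep g m → m ≤ g
Rep⇒length≤ ([] , refl , refl) = z≤n
Rep⇒length≤ (t ∷ ts , refl , refl) = +-mono-≤ (term-positive t) (Rep⇒length≤ (ts , refl , refl))

Rep⇒0<length : ∀ {g m} → Rep g m → 0 < g → 0 < m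
Rep⇒0<length ([] , refl , refl) ()
Rep⇒0<length (_ ∷ _ , refl , _) _ = s≤s z≤n

ShortRep : ℕ → Set
ShortRep g = ∃[ m ] Rep g m × 4 * m ≤ g + 3

shortRep-digit : ∀ r q → r < 4 → ShortRep q → ShortRep (r + q * 4)
shortRep-digit zero q _ (m , rep , 4m≤) =
  m , Rep-*4 rep , ≤-trans 4m≤ (+-monoˡ-≤ 3 (m≤m*n q 4))
shortRep-digit (suc r) q r<4 (m , rep , _) =
  1 + m , Rep-++ (Rep-digit (suc r) (s≤s z≤n) r<4) (Rep-*4 rep) , bound
  where
  bound : 4 * (1 + m) ≤ suc r + q * 4 + 3
  bound = begin
    4 * (1 + m)        ≡⟨ *-distribˡ-+ 4 1 m ⟩
    4 + 4 * m          ≤⟨ +-monoʳ-≤ 4 (*-monoʳ-≤ 4 (Rep⇒length≤ rep)) ⟩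
    4 + 4 * q          ≤⟨ m≤m+n (4 + 4 * q) r ⟩
    4 + 4 * q + r      ≡⟨ rearrange r q ⟩
    suc r + q * 4 + 3  ∎
    where
    open ≤-Reasoning
    rearrange : ∀ r q → 4 + 4 * q + r ≡ suc r + q * 4 + 3
    rearrange = solve-∀

shortRep : ∀ g → ShortRep g
shortRep = <-rec ShortRep step
  where
  step : ∀ g → (∀ {h} → h < g → ShortRep h) → ShortRep g
  step zero    _   = 0 , ([] , refl , refl) , z≤n
  step g@(suc _) rec = subst ShortRep (sym (m≡m%n+[m/n]*n g 4))
    (shortRep-digit (g % 4) (g / 4) (m%n<n g 4) (rec (m/n<m g 4 (s≤s (s≤s z≤n)))))

4m≤m+d+3⇒3[m+d]≤4d+3 : ∀ m d → 4 * m ≤ m + d + 3 → 3 * (m + d) ≤ 4 * d + 3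
4m≤m+d+3⇒3[m+d]≤4d+3 m d h = begin
  3 * (m + d)      ≡⟨ *-distribˡ-+ 3 m d ⟩
  3 * m + 3 * d    ≤⟨ +-monoˡ-≤ (3 * d) 3m≤d+3 ⟩
  d + 3 + 3 * d    ≡⟨ e₃ d ⟩
  4 * d + 3        ∎
  where
  open ≤-Reasoning
  e₁ : ∀ m → 4 * m ≡ m + 3 * m
  e₁ = solve-∀
  e₂ : ∀ m d → m + d + 3 ≡ m + (d + 3)
  e₂ = solve-∀
  e₃ : ∀ d → d + 3 + 3 * d ≡ 4 * d + 3
  e₃ = solve-∀
  3m≤d+3 : 3 * m ≤ d + 3
  3m≤d+3 = +-cancelˡ-≤ m (3 * m) (d + 3) (subst₂ _≤_ (e₁ m) (e₂ m d) h)

IsO⇒3g≤4x+3 : ∀ {g x} → IsO g x → 3 * g ≤ 4 * x + 3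
IsO⇒3g≤4x+3 {g} (m , (rep , minimal) , refl) with shortRep g
... | m′ , rep′ , 4m′≤ = begin
  3 * g                  ≡⟨ cong (3 *_) g≡m+d ⟩
  3 * (m + (g ∸ m))      ≤⟨ 4m≤m+d+3⇒3[m+d]≤4d+3 m (g ∸ m) 4m≤ ⟩
  4 * (g ∸ m) + 3        ∎
  where
  open ≤-Reasoning
  g≡m+d : g ≡ m + (g ∸ m)
  g≡m+d = sym (m+[n∸m]≡n (Rep⇒length≤ rep))
  4m≤ : 4 * m ≤ m + (g ∸ m) + 3
  4m≤ = ≤-trans (*-monoʳ-≤ 4 (minimal m′ rep′)) (subst (λ n → 4 * m′ ≤ n + 3) g≡m+d 4m′≤)

IsO⇒⌊3g/4⌋≤ : ∀ {g x} → IsO g x → 3 * g / 4 ≤ x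
IsO⇒⌊3g/4⌋≤ {x = x} o = ≤-pred (m<n*o⇒m/o<n (≤-<-trans (IsO⇒3g≤4x+3 o) (≤-reflexive (lemma x))))
  where
  lemma : ∀ x → suc (4 * x + 3) ≡ suc x * 4
  lemma = solve-∀

IsO+1⇒3q≤4x : ∀ {q x} → IsO (q + 1) x → 3 * q ≤ 4 * x
IsO+1⇒3q≤4x {q} {x} o = +-cancelʳ-≤ 3 (3 * q) (4 * x) (subst (_≤ 4 * x + 3) (lemma q) (IsO⇒3g≤4x+3 o))
  where
  lemma : ∀ q → 3 * (q + 1) ≡ 3 * q + 3
  lemma = solve-∀

IsO+1⇒≤ : ∀ {b y} → IsO (b + 1) y → y ≤ b
IsO+1⇒≤ {b} (m , (rep , _) , refl) = begin
  b + 1 ∸ m   ≤⟨ ∸-monoʳ-≤ (b + 1) (Rep⇒0<length rep (≤-<-trans z≤n (m<m+n b (s≤s z≤n)))) ⟩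
  b + 1 ∸ 1   ≡⟨ m+n∸n≡m b 1 ⟩
  b           ∎
  where open ≤-Reasoning

a*n+b<2^n : ∀ a b {n₀ n} → a * n₀ + b < 2 ^ n₀ → a ≤ 2 ^ n₀ → n₀ ≤′ n → a * n + b < 2 ^ n
a*n+b<2^n a b base a≤ ≤′-refl = base
a*n+b<2^n a b {n₀} base a≤ (≤′-step {n} n₀≤n) = begin-strict
  a * suc n + b        ≡⟨ cong (_+ b) (*-suc a n) ⟩
  a + a * n + b        ≡⟨ +-assoc a (a * n) b ⟩
  a + (a * n + b)      <⟨ +-monoʳ-< a (a*n+b<2^n a b base a≤ n₀≤n) ⟩
  a + 2 ^ n            ≤⟨ +-monoˡ-≤ (2 ^ n) (≤-trans a≤ (^-monoʳ-≤ 2 (≤′⇒≤ n₀≤n))) ⟩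
  2 ^ n + 2 ^ n        ≡⟨ cong (2 ^ n +_) (sym (+-identityʳ (2 ^ n))) ⟩
  2 ^ suc n            ∎
  where open ≤-Reasoning

IsO⇒3g+6<2^x : ∀ {g x} → 7 ≤ g → IsO g x → 3 * g + 6 < 2 ^ x
IsO⇒3g+6<2^x {g} {x} 7≤g o = begin-strict
  3 * g + 6       ≤⟨ +-monoˡ-≤ 6 (IsO⇒3g≤4x+3 o) ⟩
  4 * x + 3 + 6   ≡⟨ +-assoc (4 * x) 3 6 ⟩
  4 * x + 9       <⟨ a*n+b<2^n 4 9 (from-yes (29 <? 32)) (from-yes (4 ≤? 32)) (≤⇒≤′ 5≤x) ⟩
  2 ^ x           ∎
  where
  open ≤-Reasoning
  5≤x : 5 ≤ x
  5≤x = ≤-trans (/-monoˡ-≤ 4 (*-monoʳ-≤ 3 7≤g)) (IsO⇒⌊3g/4⌋≤ o)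

IsO+1⇒3q<2^x : ∀ {q x} → 6 ≤ q → IsO (q + 1) x → 3 * q < 2 ^ x
IsO+1⇒3q<2^x {q} 6≤q o =
  ≤-<-trans (≤-trans (*-monoʳ-≤ 3 (m≤m+n q 1)) (m≤m+n _ 6)) (IsO⇒3g+6<2^x (+-monoˡ-≤ 1 6≤q) o)

m≤[m+n]/[1+n]*[1+n] : ∀ m n → m ≤ (m + n) / suc n * suc n
m≤[m+n]/[1+n]*[1+n] m n = +-cancelʳ-≤ n m _ (begin
  m + n                                  ≡⟨ m≡m%n+[m/n]*n (m + n) (suc n) ⟩
  (m + n) % suc n + (m + n) / suc n * suc n ≤⟨ +-monoˡ-≤ _ (≤-pred (m%n<n (m + n) (suc n))) ⟩
  n + (m + n) / suc n * suc n            ≡⟨ +-comm n _ ⟩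
  (m + n) / suc n * suc n + n            ∎)
  where open ≤-Reasoning

decidedBelow : ∀ {P : ℕ → Set} (P? : Decidable P) n → {True (allUpTo? P? n)} → ∀ {k} → k < n → P k
decidedBelow P? n {t} = toWitness {a? = allUpTo? P? n} t

3k<2^[1+o[k+1]] : ∀ k x → IsO (k + 1) x → 3 * k < 2 * 2 ^ x
3k<2^[1+o[k+1]] k x o with k <? 6
... | yes k<6 = <-≤-trans (decidedBelow (λ k → 3 * k <? 2 * 2 ^ (3 * (k + 1) / 4)) 6 k<6)
                          (*-monoʳ-≤ 2 (^-monoʳ-≤ 2 (IsO⇒⌊3g/4⌋≤ o)))
... | no k≮6  = <-≤-trans (IsO+1⇒3q<2^x (≮⇒≥ k≮6) o) (m≤n*m (2 ^ x) 2)

k<2^[2+o[⌈k/6⌉+1]] : ∀ k x → IsO ((k + 5) / 6 + 1) x → k < 2 ^ (2 + x)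
k<2^[2+o[⌈k/6⌉+1]] k x o with k <? 31
... | yes k<31 = <-≤-trans (decidedBelow (λ k → k <? 2 ^ (2 + 3 * ((k + 5) / 6 + 1) / 4)) 31 k<31)
                           (^-monoʳ-≤ 2 (+-monoʳ-≤ 2 (IsO⇒⌊3g/4⌋≤ o)))
... | no k≮31  = begin-strict
  k             ≤⟨ m≤[m+n]/[1+n]*[1+n] k 5 ⟩
  q * 6         ≡⟨ lemma q ⟩
  2 * (3 * q)   <⟨ *-monoʳ-< 2 (IsO+1⇒3q<2^x (/-monoˡ-≤ 6 (+-monoˡ-≤ 5 (≮⇒≥ k≮31))) o) ⟩
  2 * 2 ^ x     ≤⟨ m≤n*m (2 * 2 ^ x) 2 ⟩
  2 ^ (2 + x)   ∎
  where
  open ≤-Reasoning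
  q = (k + 5) / 6
  lemma : ∀ q → q * 6 ≡ 2 * (3 * q)
  lemma = solve-∀

k<2^o[⌈2k/3⌉+1] : ∀ k x → IsO ((2 * k + 2) / 3 + 1) x → k < 2 ^ x
k<2^o[⌈2k/3⌉+1] k x o with k <? 8
... | yes k<8 = <-≤-trans (decidedBelow (λ k → k <? 2 ^ (3 * ((2 * k + 2) / 3 + 1) / 4)) 8 k<8)
                          (^-monoʳ-≤ 2 (IsO⇒⌊3g/4⌋≤ o))
... | no k≮8  = begin-strict
  k       ≤⟨ m≤n*m k 2 ⟩
  2 * k   ≤⟨ m≤[m+n]/[1+n]*[1+n] (2 * k) 2 ⟩
  q * 3   ≡⟨ *-comm q 3 ⟩
  3 * q   <⟨ IsO+1⇒3q<2^x (/-monoˡ-≤ 3 (+-monoˡ-≤ 2 (*-monoʳ-≤ 2 (≮⇒≥ k≮8)))) o ⟩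
  2 ^ x   ∎
  where
  open ≤-Reasoning
  q = (2 * k + 2) / 3

3k<2^o[2k-2] : ∀ k → 4 ≤ k → ∀ x → IsO (2 * k ∸ 2) x → 3 * k < 2 ^ x
3k<2^o[2k-2] k 4≤k x o with m≤n⇒m<n∨m≡n 4≤k
... | inj₂ refl = <-≤-trans (from-yes (12 <? 16)) (^-monoʳ-≤ 2 (IsO⇒⌊3g/4⌋≤ o))
... | inj₁ 5≤k  = begin-strict
  3 * k           ≤⟨ m≤n*m (3 * k) 2 ⟩
  2 * (3 * k)     ≡⟨ lemma k ⟩
  3 * (2 * k)     ≡⟨ cong (3 *_) (sym (m∸n+n≡m (*-monoʳ-≤ 2 (≤-trans (from-yes (1 ≤? 4)) 4≤k)))) ⟩
  3 * (t + 2)     ≡⟨ *-distribˡ-+ 3 t 2 ⟩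
  3 * t + 6       <⟨ IsO⇒3g+6<2^x (≤-trans (from-yes (7 ≤? 8)) (∸-monoˡ-≤ 2 (*-monoʳ-≤ 2 5≤k))) o ⟩
  2 ^ x           ∎
  where
  open ≤-Reasoning
  t = 2 * k ∸ 2
  lemma : ∀ k → 2 * (3 * k) ≡ 3 * (2 * k)
  lemma = solve-∀

k≤2^o[k-1] : ∀ k → 4 ≤ k → ∀ x → IsO (k ∸ 1) x → k ≤ 2 ^ x × (5 ≤ k → k < 2 ^ x)
k≤2^o[k-1] k 4≤k x o with k <? 8
... | yes k<8 = ≤-trans (proj₁ decided) 2^X≤2^x , λ 5≤k → <-≤-trans (proj₂ decided 5≤k) 2^X≤2^x
  where
  X : ℕ → ℕ
  X k = 3 * (k ∸ 1) / 4
  decided : k ≤ 2 ^ X k × (5 ≤ k → k < 2 ^ X k)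
  decided = decidedBelow (λ k → 4 ≤? k →-dec (k ≤? 2 ^ X k ×-dec (5 ≤? k →-dec k <? 2 ^ X k))) 8 k<8 4≤k
  2^X≤2^x : 2 ^ X k ≤ 2 ^ x
  2^X≤2^x = ^-monoʳ-≤ 2 (IsO⇒⌊3g/4⌋≤ o)
... | no k≮8 = <⇒≤ k<2^x , λ _ → k<2^x
  where
  open ≤-Reasoning
  k<2^x : k < 2 ^ x
  k<2^x = begin-strict
    k                   ≤⟨ m≤n+m∸n k 1 ⟩
    1 + (k ∸ 1)         ≤⟨ +-mono-≤ (from-yes (1 ≤? 6)) (m≤n*m (k ∸ 1) 3) ⟩
    6 + 3 * (k ∸ 1)     ≡⟨ +-comm 6 _ ⟩
    3 * (k ∸ 1) + 6     <⟨ IsO⇒3g+6<2^x (∸-monoˡ-≤ 1 (≮⇒≥ k≮8)) o ⟩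
    2 ^ x               ∎

k≤2^⌊[k+1]/2⌋ : ∀ k → k ≤ 2 ^ ((k + 1) / 2) × (k ≢ 2 → k ≢ 4 → k < 2 ^ ((k + 1) / 2))
k≤2^⌊[k+1]/2⌋ k with k <? 5
... | yes k<5 = decidedBelow (λ k → k ≤? 2 ^ h k ×-dec (¬? (k ≟ 2) →-dec (¬? (k ≟ 4) →-dec k <? 2 ^ h k))) 5 k<5
  where
  h : ℕ → ℕ
  h k = (k + 1) / 2
... | no k≮5  = <⇒≤ k<2^h , λ _ _ → k<2^h
  where
  open ≤-Reasoning
  h = (k + 1) / 2
  k<2^h : k < 2 ^ h
  k<2^h = begin-strict
    k           ≤⟨ m≤[m+n]/[1+n]*[1+n] k 1 ⟩
    h * 2       ≡⟨ *-comm h 2 ⟩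
    2 * h       ≡⟨ +-identityʳ (2 * h) ⟨
    2 * h + 0   <⟨ a*n+b<2^n 2 0 (from-yes (6 <? 8)) (from-yes (2 ≤? 8)) (≤⇒≤′ (/-monoˡ-≤ 2 (+-monoˡ-≤ 1 (≮⇒≥ k≮5)))) ⟩
    2 ^ h       ∎

o[⌈k/8⌉+1]+⌊k/6⌋≤o[⌈k/2⌉+1] : ∀ k x y → IsO ((k + 1) / 2 + 1) x → IsO ((k + 7) / 8 + 1) y → y + k / 6 ≤ x
o[⌈k/8⌉+1]+⌊k/6⌋≤o[⌈k/2⌉+1] k x y ox oy = ≤-trans (+-monoˡ-≤ (k / 6) (IsO+1⇒≤ oy)) b+c≤x
  where
  p = (k + 1) / 2
  b = (k + 7) / 8
  c = k / 6
  b+c≤x : b + c ≤ x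
  b+c≤x with k <? 11
  ... | yes k<11 = ≤-trans (decidedBelow (λ k → (k + 7) / 8 + k / 6 ≤? 3 * ((k + 1) / 2 + 1) / 4) 11 k<11)
                           (IsO⇒⌊3g/4⌋≤ ox)
  ... | no k≮11  = *-cancelˡ-≤ 24 (begin
    24 * (b + c)                  ≡⟨ e₁ b c ⟩
    3 * (b * 8) + 4 * (c * 6)     ≤⟨ +-mono-≤ (*-monoʳ-≤ 3 (m/n*n≤m (k + 7) 8)) (*-monoʳ-≤ 4 (m/n*n≤m k 6)) ⟩
    3 * (k + 7) + 4 * k           ≡⟨ e₂ k ⟩
    7 * k + 21                    ≤⟨ +-monoʳ-≤ (7 * k) (≤-trans (from-yes (21 ≤? 22)) (*-monoʳ-≤ 2 (≮⇒≥ k≮11))) ⟩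
    7 * k + 2 * k                 ≡⟨ e₃ k ⟩
    9 * k                         ≤⟨ *-monoʳ-≤ 9 (m≤[m+n]/[1+n]*[1+n] k 1) ⟩
    9 * (p * 2)                   ≡⟨ e₄ p ⟩
    6 * (3 * p)                   ≤⟨ *-monoʳ-≤ 6 (IsO+1⇒3q≤4x ox) ⟩
    6 * (4 * x)                   ≡⟨ e₅ x ⟩
    24 * x                        ∎)
    where
    open ≤-Reasoning
    e₁ : ∀ b c → 24 * (b + c) ≡ 3 * (b * 8) + 4 * (c * 6)
    e₁ = solve-∀
    e₂ : ∀ k → 3 * (k + 7) + 4 * k ≡ 7 * k + 21
    e₂ = solve-∀
    e₃ : ∀ k → 7 * k + 2 * k ≡ 9 * k
    e₃ = solve-∀
    e₄ : ∀ p → 9 * (p * 2) ≡ 6 * (3 * p)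
    e₄ = solve-∀
    e₅ : ∀ x → 6 * (4 * x) ≡ 24 * x
    e₅ = solve-∀

k≤2^o[⌈k/2⌉+1] : ∀ k x → IsO ((k + 1) / 2 + 1) x → k ≤ 2 ^ x × (k ≢ 2 → k ≢ 4 → k ≢ 8 → k < 2 ^ x)
k≤2^o[⌈k/2⌉+1] k x o with k <? 11
... | yes k<11 = ≤-trans (proj₁ decided) 2^X≤2^x , λ ≢2 ≢4 ≢8 → <-≤-trans (proj₂ decided ≢2 ≢4 ≢8) 2^X≤2^x
  where
  X : ℕ → ℕ
  X k = 3 * ((k + 1) / 2 + 1) / 4
  decided : k ≤ 2 ^ X k × (k ≢ 2 → k ≢ 4 → k ≢ 8 → k < 2 ^ X k)
  decided = decidedBelow (λ k → k ≤? 2 ^ X k ×-dec (¬? (k ≟ 2) →-dec (¬? (k ≟ 4) →-dec (¬? (k ≟ 8) →-dec k <? 2 ^ X k)))) 11 k<11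
  2^X≤2^x : 2 ^ X k ≤ 2 ^ x
  2^X≤2^x = ^-monoʳ-≤ 2 (IsO⇒⌊3g/4⌋≤ o)
... | no k≮11 = <⇒≤ k<2^x , λ _ _ _ → k<2^x
  where
  open ≤-Reasoning
  q = (k + 1) / 2
  k<2^x : k < 2 ^ x
  k<2^x = begin-strict
    k       ≤⟨ m≤[m+n]/[1+n]*[1+n] k 1 ⟩
    q * 2   ≤⟨ *-monoʳ-≤ q (from-yes (2 ≤? 3)) ⟩
    q * 3   ≡⟨ *-comm q 3 ⟩
    3 * q   <⟨ IsO+1⇒3q<2^x (/-monoˡ-≤ 2 (+-monoˡ-≤ 1 (≮⇒≥ k≮11))) o ⟩
    2 ^ x   ∎

proposition2p2 : (k : ℕ) → 1 ≤ k →
      -- (3/2) k < 2^{o(k+1)}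
      (∀ x → IsO (k + 1) x → 3 * k < 2 * 2 ^ x)
    × -- k < 2^{2 + o(⌈k/6⌉ + 1)}
      (∀ x → IsO ((k + 5) / 6 + 1) x → k < 2 ^ (2 + x))
    × -- k < 2^{o(⌈2k/3⌉ + 1)}
      (∀ x → IsO ((2 * k + 2) / 3 + 1) x → k < 2 ^ x)
    × -- 3k < 2^{o(2k-2)} for k ≥ 4
      (4 ≤ k → ∀ x → IsO (2 * k ∸ 2) x → 3 * k < 2 ^ x)
    × -- k ≤ 2^{o(k-1)} for k ≥ 4, strictly for k ≥ 5
      (4 ≤ k → ∀ x → IsO (k ∸ 1) x → k ≤ 2 ^ x × (5 ≤ k → k < 2 ^ x))
    × -- k ≤ 2^{⌊(k+1)/2⌋}, strictly for k ≠ 2, 4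
      (k ≤ 2 ^ ((k + 1) / 2) × (k ≢ 2 → k ≢ 4 → k < 2 ^ ((k + 1) / 2)))
    × -- o(⌈k/2⌉ + 1) - ⌊k/6⌋ ≥ o(⌈k/8⌉ + 1)
      (∀ x y → IsO ((k + 1) / 2 + 1) x → IsO ((k + 7) / 8 + 1) y → y + k / 6 ≤ x)
    × -- k ≤ 2^{o(⌈k/2⌉ + 1)}, strictly for k ≠ 2, 4, 8
      (∀ x → IsO ((k + 1) / 2 + 1) x → k ≤ 2 ^ x × (k ≢ 2 → k ≢ 4 → k ≢ 8 → k < 2 ^ x))
proposition2p2 k _ =
    3k<2^[1+o[k+1]] k
  , k<2^[2+o[⌈k/6⌉+1]] k
  , k<2^o[⌈2k/3⌉+1] k
  , 3k<2^o[2k-2] k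
  , k≤2^o[k-1] k
  , k≤2^⌊[k+1]/2⌋ k
  , o[⌈k/8⌉+1]+⌊k/6⌋≤o[⌈k/2⌉+1] k
  , k≤2^o[⌈k/2⌉+1] k
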